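{- For all integers $s\ge 3$ and $n\ge 3$, $r_3(K_s,P_n)\le f(s;n-2)$.
   Context: For a coloring $\chi$ of the pairs of $[N]=\{1,\dots,N\}$ with integer colors, a triple $u<v<w$ is non-increasing if either $\chi(u,v)=\chi(u,w)\ge\chi(v,w)$ or $\chi(u,v)\ge\chi(v,w)=\chi(u,w)$; a set $S\subset[N]$ is non-increasing if all its triples are. $f(s;q)$ denotes the minimum $N$ such that for every coloring of the pairs of $[N]$ with at most $q$ colors $\kappa_1<\dots<\kappa_q$ (integers), there is a set $S\subset[N]$ of size $s$ that is non-increasing. $r_3(K_s,P_n)$ is the minimum $N$ such that every red/blue coloring of the triples of $[N]$ contains either a red complete $3$-uniform hypergraph on $s$ vertices (i.e., $s$ vertices all of whose triples are red) or a blue monotone path on $n$ vertices, i.e., vertices $x_1<x_2<\dots<x_n$ in $[N]$ with every triple $\{x_i,x_{i+1},x_{i+2}\}$, $1\le i\le n-2$, blue. -}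

module Defs where

open import Data.Nat using (ℕ; suc; _+_) renaming (_<_ to _<ℕ_)
open import Data.Integer using (ℤ) renaming (_≥_ to _≥ℤ_)
open import Data.Fin using (Fin; _<_)
open import Data.Fin.Subset using (Subset; _∈_; ∣_∣)
open import Data.Product using (Σ; ∃; _×_)
open import Data.Sum using (_⊎_)
open import Relation.Binary.PropositionalEquality using (_≡_)
open import Relation.Nullary using (¬_)

-- Vertex set [N] is represented by Fin N (order preserved: toℕ i ↔ i+1).

-- A coloring of the pairs of [N] by integers; only χ u v with u < v is used.
PairColoring : ℕ → Set
PairColoring N = Fin N → Fin N → ℤ

AtMostColors : (N q : ℕ) → PairColoring N → Set
AtMostColors N q χ =
  Σ (Fin q → ℤ) λ κ → ∀ (u v : Fin N) → u < v → ∃ λ (i : Fin q) → χ u v ≡ κ i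

NonIncTriple : {N : ℕ} → PairColoring N → Fin N → Fin N → Fin N → Set
NonIncTriple χ u v w =
  (χ u v ≡ χ u w × χ u w ≥ℤ χ v w) ⊎ (χ u v ≥ℤ χ v w × χ v w ≡ χ u w)

NonIncSet : {N : ℕ} → PairColoring N → Subset N → Set
NonIncSet χ S = ∀ u v w → u ∈ S → v ∈ S → w ∈ S → u < v → v < w → NonIncTriple χ u v w

FProp : (s q N : ℕ) → Set
FProp s q N = (χ : PairColoring N) → AtMostColors N q χ →
  Σ (Subset N) λ S → (∣ S ∣ ≡ s) × NonIncSet χ S

data Color : Set where
  red blue : Color

-- Only c u v w with u < v < w is used.
TripleColoring : ℕ → Set
TripleColoring N = Fin N → Fin N → Fin N → Color

RedClique : {N : ℕ} → TripleColoring N → ℕ → Set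
RedClique {N} c s = Σ (Subset N) λ S → (∣ S ∣ ≡ s) ×
  (∀ u v w → u ∈ S → v ∈ S → w ∈ S → u < v → v < w → c u v w ≡ red)

-- A blue monotone path on n vertices x 0 < x 1 < … < x (n-1)
-- (sequence values at indices ≥ n are irrelevant).
BlueMonotonePath : {N : ℕ} → TripleColoring N → ℕ → Set
BlueMonotonePath {N} c n = Σ (ℕ → Fin N) λ x →
  (∀ i → suc i <ℕ n → x i < x (suc i)) ×
  (∀ i → suc (suc i) <ℕ n → c (x i) (x (suc i)) (x (suc (suc i))) ≡ blue)

RProp : (s n N : ℕ) → Set
RProp s n N = (c : TripleColoring N) → RedClique c s ⊎ BlueMonotonePath c n

IsMin : (ℕ → Set) → ℕ → Set
IsMin P N = P N × (∀ M → M <ℕ N → ¬ P M)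

-- Given a red/blue coloring c of the triples of [N], let ρ(u,v) be the number of vertices of a
-- longest blue monotone path beginning u < v. For a blue triple u < v < w, prepending u to a path
-- beginning v, w shows ρ(u,v) > ρ(v,w). Colour pairs by χ(u,v) = -ρ(u,v): a non-increasing
-- triple has χ(u,v) ≥ χ(v,w), so it cannot be blue. If no blue path has n vertices, ρ takes
-- values in [2, n), so χ uses at most n-2 colours and a non-increasing s-set is a red clique.
-- Hence f(s;n-2) has the property defining r_3(K_s,P_n); the least number with that property
-- exists because the property is decidable for each N by exhaustive search.
module Submission where

open import Defs
open import Data.Nat using (ℕ; zero; suc; _+_; _∸_; _≤_; z≤n; s≤s; _≤?_; _≟_)
  renaming (_<_ to _<ℕ_; _<?_ to _<ℕ?_)
open import Data.Nat.Properties
  using (≤-refl; ≤-trans; ≤-antisym; ≤-pred; <⇒≤; <⇒≱; ∸-monoʳ-≤; ∸-monoˡ-<; +-∸-assoc;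
         m+[n∸m]≡n; m+n∸m≡n; m≤n⇒m<n∨m≡n; m≤n+m; ≰⇒>; ≤-reflexive; allUpTo?; anyUpTo?)
open import Data.Nat.Induction using (<-rec)
open import Data.Integer using (-[1+_]) renaming (_≤_ to _≤ℤ_)
open import Data.Integer.Properties using (drop‿-≤-)
open import Data.Fin as Fin using (Fin; toℕ; fromℕ<; _<_)
open import Data.Fin.Properties using (any?; all?; toℕ-fromℕ<; toℕ<n; ¬Fin0) renaming (_<?_ to _<ᶠ?_)
open import Data.Fin.Subset using (∣_∣)
open import Data.Fin.Subset.Properties using (anySubset?; _∈?_)
open import Data.List using (List; map; allFin)
open import Data.List.Extrema.Nat using (max; xs≤max; v≤max⁺; argmax-sel)
open import Data.List.Membership.Propositional.Properties using (∈-map⁺; ∈-map⁻; ∈-allFin)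
import Data.List.Relation.Unary.All as All
open import Data.Vec.Functional using (Vector; []; _∷_; head; tail)
open import Data.Vec.Functional.Relation.Binary.Pointwise using (Pointwise)
open import Data.Product using (Σ; ∃; _×_; _,_)
open import Data.Sum using (_⊎_; inj₁; inj₂)
open import Function using (_∘_; _$_)
open import Level using (0ℓ)
open import Relation.Binary using (Rel; Reflexive; Symmetric; _Respects_; DecidableEquality)
open import Relation.Binary.PropositionalEquality
  using (_≡_; refl; sym; trans; cong; cong₂; subst; subst₂)
open import Relation.Nullary using (Dec; yes; no; ¬?; contradiction)
open import Relation.Nullary.Decidable using (_×-dec_; _⊎-dec_; _→-dec_; map′; decidable-stable)
open import Relation.Unary using (Pred; Decidable)

_≟ᶜ_ : DecidableEquality Color
red  ≟ᶜ red  = yes refl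
red  ≟ᶜ blue = no λ ()
blue ≟ᶜ red  = no λ ()
blue ≟ᶜ blue = yes refl

when : {A : Set} → Dec A → ℕ → ℕ
when (yes _) m = m
when (no _)  _ = 0

when-yes : {A : Set} (d : Dec A) {m : ℕ} → A → when d m ≡ m
when-yes (yes _) _ = refl
when-yes (no ¬a) a = contradiction a ¬a

when-sel : {A : Set} (d : Dec A) {m : ℕ} → (A × when d m ≡ m) ⊎ when d m ≡ 0
when-sel (yes a) = inj₁ (a , refl)
when-sel (no _)  = inj₂ refl

nonIncTriple⇒≥ : ∀ {N} {χ : PairColoring N} {u v w} → NonIncTriple χ u v w → χ v w ≤ℤ χ u v
nonIncTriple⇒≥ {χ = χ} {u} {v} {w} (inj₁ (χuv≡χuw , χvw≤χuw)) =
  subst (χ v w ≤ℤ_) (sym χuv≡χuw) χvw≤χuw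
nonIncTriple⇒≥ (inj₂ (χvw≤χuv , _)) = χvw≤χuv

atMostColors-range : ∀ {N} (ρ : Fin N → Fin N → ℕ) (m q : ℕ) →
  (∀ {u v} → u < v → m ≤ ρ u v × ρ u v <ℕ m + q) → AtMostColors N q (λ u v → -[1+ ρ u v ])
atMostColors-range ρ m q inRange = (λ i → -[1+ m + toℕ i ]) , λ u v u<v →
  let (m≤ρ , ρ<m+q) = inRange u<v
      offset<q = subst (ρ u v ∸ m <ℕ_) (m+n∸m≡n m q) (∸-monoˡ-< ρ<m+q m≤ρ)
  in fromℕ< offset<q ,
     cong -[1+_] (sym (trans (cong (m +_) (toℕ-fromℕ< offset<q)) (m+[n∸m]≡n m≤ρ)))

module LongestBluePath {N : ℕ} (c : TripleColoring N) where

  BlueStep : Fin N → Fin N → Fin N → Set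
  BlueStep u v w = v < w × c u v w ≡ blue

  blueStep? : ∀ u v w → Dec (BlueStep u v w)
  blueStep? u v w = (v <ᶠ? w) ×-dec (c u v w ≟ᶜ blue)

  -- For u < v, height k u v is the number of vertices of a longest blue monotone path that
  -- starts with u, v and has at most k + 2 vertices.
  height : ℕ → Fin N → Fin N → ℕ
  extensionHeights : ℕ → Fin N → Fin N → List ℕ

  height zero    u v = 2
  height (suc k) u v = max (height k u v) (extensionHeights k u v)

  extensionHeights k u v = map (λ w → when (blueStep? u v w) (suc (height k v w))) (allFin N)

  height≤height-suc : ∀ k u v → height k u v ≤ height (suc k) u v
  height≤height-suc k u v = v≤max⁺ (height k u v) (extensionHeights k u v) (inj₁ ≤-refl)

  height≥2 : ∀ k u v → 2 ≤ height k u v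
  height≥2 zero    u v = ≤-refl
  height≥2 (suc k) u v = ≤-trans (height≥2 k u v) (height≤height-suc k u v)

  height-mono : ∀ {k k′} u v → k ≤ k′ → height k u v ≤ height k′ u v
  height-mono {k′ = zero}   u v z≤n = ≤-refl
  height-mono {k′ = suc k′} u v k≤1+k′ with m≤n⇒m<n∨m≡n k≤1+k′
  ... | inj₁ k<1+k′ = ≤-trans (height-mono u v (≤-pred k<1+k′)) (height≤height-suc k′ u v)
  ... | inj₂ refl   = ≤-refl

  height-extend : ∀ k {u v w} → BlueStep u v w → suc (height k v w) ≤ height (suc k) u v
  height-extend k {u} {v} {w} step =
    subst (_≤ height (suc k) u v) (when-yes (blueStep? u v w) step)
      (All.lookup (xs≤max (height k u v) (extensionHeights k u v)) (∈-map⁺ _ (∈-allFin w)))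

  height-select : ∀ k u v →
    height (suc k) u v ≤ height k u v ⊎
    ∃ λ w → BlueStep u v w × height (suc k) u v ≡ suc (height k v w)
  height-select k u v with argmax-sel (λ m → m) (height k u v) (extensionHeights k u v)
  ... | inj₁ eq = inj₁ (≤-reflexive eq)
  ... | inj₂ ∈xs with ∈-map⁻ _ ∈xs
  ...   | w , _ , eq with when-sel (blueStep? u v w) {suc (height k v w)}
  ...     | inj₁ (step , eq′) = inj₂ (w , step , trans eq eq′)
  ...     | inj₂ eq′ = inj₁ (subst (_≤ height k u v) (sym (trans eq eq′)) z≤n)

  data BluePath : ℕ → Fin N → Fin N → Set where
    edge   : ∀ {u v} → u < v → BluePath 2 u v
    extend : ∀ {j u v w} → u < v → c u v w ≡ blue → BluePath j v w → BluePath (suc j) u v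

  bluePath : ∀ k {j u v} → 2 ≤ j → j ≤ height k u v → u < v → BluePath j u v
  bluePath zero {j} {u} {v} 2≤j j≤2 u<v =
    subst (λ i → BluePath i u v) (≤-antisym 2≤j j≤2) (edge u<v)
  bluePath (suc k) 2≤j@(s≤s (s≤s z≤n)) j≤h u<v with height-select k _ _
  ... | inj₁ h≤ = bluePath k 2≤j (≤-trans j≤h h≤) u<v
  bluePath (suc k) {suc (suc zero)} _ _ u<v | inj₂ _ = edge u<v
  bluePath (suc k) {suc (suc (suc j))} _ j≤h u<v | inj₂ (w , (v<w , blue-uvw) , eq) =
    extend u<v blue-uvw (bluePath k (s≤s (s≤s z≤n)) (≤-pred (subst (_ ≤_) eq j≤h)) v<w)

  vertex : ∀ {j u v} → BluePath j u v → ℕ → Fin N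
  vertex (edge {u} _)          zero    = u
  vertex (edge {v = v} _)      (suc _) = v
  vertex (extend {u = u} _ _ _) zero   = u
  vertex (extend _ _ p)        (suc i) = vertex p i

  vertex-0 : ∀ {j u v} (p : BluePath j u v) → vertex p 0 ≡ u
  vertex-0 (edge _)       = refl
  vertex-0 (extend _ _ _) = refl

  vertex-1 : ∀ {j u v} (p : BluePath j u v) → vertex p 1 ≡ v
  vertex-1 (edge _)       = refl
  vertex-1 (extend _ _ p) = vertex-0 p

  vertex-increasing : ∀ {j u v} (p : BluePath j u v) →
    ∀ i → suc i <ℕ j → vertex p i < vertex p (suc i)
  vertex-increasing (edge u<v)         zero    _          = u<v
  vertex-increasing (edge _)           (suc i) (s≤s (s≤s ()))
  vertex-increasing (extend u<v _ p)   zero    _          = subst (_ <_) (sym (vertex-0 p)) u<v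
  vertex-increasing (extend _ _ p)     (suc i) (s≤s i<j)  = vertex-increasing p i i<j

  vertex-blue : ∀ {j u v} (p : BluePath j u v) →
    ∀ i → suc (suc i) <ℕ j → c (vertex p i) (vertex p (suc i)) (vertex p (suc (suc i))) ≡ blue
  vertex-blue (edge _) i (s≤s (s≤s ()))
  vertex-blue (extend {u = u} _ blue-uvw p) zero _ =
    subst₂ (λ v w → c u v w ≡ blue) (sym (vertex-0 p)) (sym (vertex-1 p)) blue-uvw
  vertex-blue (extend _ _ p) (suc i) (s≤s i<j) = vertex-blue p i i<j

  blueMonotonePath : ∀ {j u v} → BluePath j u v → BlueMonotonePath c j
  blueMonotonePath p = vertex p , vertex-increasing p , vertex-blue p

  -- The fuel N ∸ toℕ u leaves room for every path from u and strictly decreases along a path;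
  -- the latter is what makes rank-decreasing go through.
  rank : Fin N → Fin N → ℕ
  rank u v = height (N ∸ toℕ u) u v

  rank-decreasing : ∀ {u v w} → u < v → BlueStep u v w → rank v w <ℕ rank u v
  rank-decreasing {u} {v} {w} u<v step =
    subst (λ k → suc (rank v w) ≤ height k u v) (sym fuel-suc)
      (≤-trans (s≤s (height-mono v w (∸-monoʳ-≤ N u<v))) (height-extend (N ∸ suc (toℕ u)) step))
    where
    fuel-suc : N ∸ toℕ u ≡ suc (N ∸ suc (toℕ u))
    fuel-suc = +-∸-assoc 1 (toℕ<n u)

  χ : PairColoring N
  χ u v = -[1+ rank u v ]

  nonIncreasing⇒red : ∀ {u v w} → u < v → v < w → NonIncTriple χ u v w → c u v w ≡ red
  nonIncreasing⇒red {u} {v} {w} u<v v<w nonInc with c u v w in eq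
  ... | red  = refl
  ... | blue = contradiction (drop‿-≤- (nonIncTriple⇒≥ {χ = χ} {u} {v} {w} nonInc))
                             (<⇒≱ (rank-decreasing u<v (v<w , eq)))

  shortRanks⇒redClique : ∀ {s n} → 2 ≤ n → (∀ {u v} → u < v → rank u v <ℕ n) →
    FProp s (n ∸ 2) N → RedClique c s
  shortRanks⇒redClique {n = n} 2≤n short fProp =
    let (S , ∣S∣≡s , nonInc) = fProp χ (atMostColors-range rank 2 (n ∸ 2) ranksInRange)
    in S , ∣S∣≡s , λ u v w u∈S v∈S w∈S u<v v<w →
         nonIncreasing⇒red u<v v<w (nonInc u v w u∈S v∈S w∈S u<v v<w)
    where
    ranksInRange : ∀ {u v} → u < v → 2 ≤ rank u v × rank u v <ℕ 2 + (n ∸ 2)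
    ranksInRange {u} {v} u<v =
      height≥2 (N ∸ toℕ u) u v , subst (rank u v <ℕ_) (sym (m+[n∸m]≡n 2≤n)) (short u<v)

  redClique⊎blueMonotonePath : ∀ {s n} → 2 ≤ n → FProp s (n ∸ 2) N →
    RedClique c s ⊎ BlueMonotonePath c n
  redClique⊎blueMonotonePath {n = n} 2≤n fProp
    with any? (λ u → any? (λ v → (u <ᶠ? v) ×-dec (n ≤? rank u v)))
  ... | yes (u , v , u<v , n≤rank) =
    inj₂ (blueMonotonePath (bluePath (N ∸ toℕ u) 2≤n n≤rank u<v))
  ... | no ∄long = inj₁ (shortRanks⇒redClique 2≤n short fProp)
    where
    short : ∀ {u v} → u < v → rank u v <ℕ n
    short {u} {v} u<v = ≰⇒> λ n≤rank → ∄long (u , v , u<v , n≤rank)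

Searchable : (B : Set) → Rel B 0ℓ → Set₁
Searchable B _≈_ = ∀ {P : Pred B 0ℓ} → P Respects _≈_ → Decidable P → Dec (∃ P)

searchable⇒∀? : ∀ {B _≈_} {P : Pred B 0ℓ} → Symmetric _≈_ → Searchable B _≈_ →
  P Respects _≈_ → Decidable P → Dec (∀ x → P x)
searchable⇒∀? ≈-sym search resp P?
  with search (λ x≈y ¬Px Py → ¬Px (resp (≈-sym x≈y) Py)) (λ x → ¬? (P? x))
... | yes (x , ¬Px) = no λ ∀P → ¬Px (∀P x)
... | no ∄¬P = yes λ x → decidable-stable (P? x) λ ¬Px → ∄¬P (x , ¬Px)

color-searchable : Searchable Color _≡_
color-searchable _ P? with P? red | P? blue
... | yes Pr | _      = yes (red , Pr)
... | no _   | yes Pb = yes (blue , Pb)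
... | no ¬Pr | no ¬Pb = no λ { (red , Pr) → ¬Pr Pr ; (blue , Pb) → ¬Pb Pb }

vector-searchable : ∀ {B _≈_} → Reflexive _≈_ → Searchable B _≈_ →
  ∀ k → Searchable (Vector B k) (Pointwise _≈_)
vector-searchable _ _ zero {P} resp P? =
  map′ (λ P[] → [] , P[]) (λ (xs , Pxs) → resp (λ ()) Pxs) (P? [])
vector-searchable ≈-refl search (suc k) {P} resp P? =
  map′ (λ (x , xs , Px∷xs) → x ∷ xs , Px∷xs)
       (λ (xs , Pxs) → head xs , tail xs , resp (λ { Fin.zero → ≈-refl ; (Fin.suc _) → ≈-refl }) Pxs)
       (search (λ x≈y (xs , Px∷xs) → xs , resp (λ { Fin.zero → x≈y ; (Fin.suc _) → ≈-refl }) Px∷xs)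
               (λ x → vector-searchable ≈-refl search k
                        (λ xs≈ys → resp (λ { Fin.zero → ≈-refl ; (Fin.suc i) → xs≈ys i }))
                        (λ xs → P? (x ∷ xs))))

AgreeBelow : {A : Set} → ℕ → Rel (ℕ → A) 0ℓ
AgreeBelow k x y = ∀ {i} → i <ℕ k → x i ≡ y i

_∷ˢ_ : {A : Set} → A → (ℕ → A) → ℕ → A
(a ∷ˢ x) zero    = a
(a ∷ˢ x) (suc i) = x i

sequence-searchable : ∀ {m} k → Searchable (ℕ → Fin m) (AgreeBelow k)
sequence-searchable {zero}  zero _ _ = no λ (x , _) → ¬Fin0 (x 0)
sequence-searchable {suc m} zero resp P? =
  map′ (λ P0 → (λ _ → Fin.zero) , P0) (λ (x , Px) → resp (λ ()) Px) (P? (λ _ → Fin.zero))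
sequence-searchable (suc k) {P} resp P? =
  map′ (λ (a , x , Pa∷x) → a ∷ˢ x , Pa∷x)
       (λ (x , Px) → x 0 , x ∘ suc , resp (λ { {zero} _ → refl ; {suc i} _ → refl }) Px)
       (any? λ a → sequence-searchable k
                     (λ x≈y → resp (λ { {zero} _ → refl ; {suc i} (s≤s i<k) → x≈y i<k }))
                     (λ x → P? (a ∷ˢ x)))

redClique? : ∀ {N} (c : TripleColoring N) s → Dec (RedClique c s)
redClique? c s = anySubset? λ S → (∣ S ∣ ≟ s) ×-dec
  all? (λ u → all? (λ v → all? (λ w →
    (u ∈? S) →-dec (v ∈? S) →-dec (w ∈? S) →-dec (u <ᶠ? v) →-dec (v <ᶠ? w) →-dec (c u v w ≟ᶜ red))))

guardedAllUpTo? : ∀ {Q : Pred ℕ 0ℓ} d n → Decidable Q → Dec (∀ i → d + i <ℕ n → Q i)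
guardedAllUpTo? d n Q? =
  map′ (λ ∀Q i d+i<n → ∀Q (≤-trans (s≤s (m≤n+m _ d)) d+i<n) d+i<n) (λ ∀Q {i} _ → ∀Q i)
       (allUpTo? (λ i → (d + i <ℕ? n) →-dec Q? i) n)

blueMonotonePath? : ∀ {N} (c : TripleColoring N) n → Dec (BlueMonotonePath c n)
blueMonotonePath? c n = sequence-searchable n respects λ x →
  guardedAllUpTo? 1 n (λ i → x i <ᶠ? x (suc i)) ×-dec
  guardedAllUpTo? 2 n (λ i → c (x i) (x (suc i)) (x (suc (suc i))) ≟ᶜ blue)
  where
  respects : (λ x → (∀ i → suc i <ℕ n → x i < x (suc i)) ×
                    (∀ i → suc (suc i) <ℕ n → c (x i) (x (suc i)) (x (suc (suc i))) ≡ blue))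
             Respects AgreeBelow n
  respects x≈y (increasing , blueTriples) =
    (λ i 1+i<n → subst₂ _<_ (x≈y (<⇒≤ 1+i<n)) (x≈y 1+i<n) (increasing i 1+i<n)) ,
    (λ i 2+i<n → trans (sym (cong₂ _$_ (cong₂ c (x≈y (<⇒≤ (<⇒≤ 2+i<n))) (x≈y (<⇒≤ 2+i<n)))
                                       (x≈y 2+i<n)))
                       (blueTriples i 2+i<n))

SameColoring : ∀ {N} → Rel (TripleColoring N) 0ℓ
SameColoring = Pointwise (Pointwise (Pointwise _≡_))

tripleColoring-searchable : ∀ N → Searchable (TripleColoring N) SameColoring
tripleColoring-searchable N =
  vector-searchable (λ _ _ → refl)
    (vector-searchable (λ _ → refl) (vector-searchable refl color-searchable N) N) N

rProp? : ∀ s n N → Dec (RProp s n N)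
rProp? s n N =
  searchable⇒∀? {_≈_ = SameColoring} (λ c≈c′ u v w → sym (c≈c′ u v w))
    (tripleColoring-searchable N) respects (λ c → redClique? c s ⊎-dec blueMonotonePath? c n)
  where
  respects : (λ c → RedClique c s ⊎ BlueMonotonePath c n) Respects SameColoring
  respects c≈c′ (inj₁ (S , ∣S∣≡s , allRed)) =
    inj₁ (S , ∣S∣≡s , λ u v w u∈S v∈S w∈S u<v v<w →
      trans (sym (c≈c′ u v w)) (allRed u v w u∈S v∈S w∈S u<v v<w))
  respects c≈c′ (inj₂ (x , increasing , blueTriples)) =
    inj₂ (x , increasing , λ i 2+i<n → trans (sym (c≈c′ _ _ _)) (blueTriples i 2+i<n))

least : {P : Pred ℕ 0ℓ} → Decidable P → ∀ {F} → P F → Σ ℕ λ R → IsMin P R × R ≤ F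
least {P} P? {F} = <-rec (λ F → P F → Σ ℕ λ R → IsMin P R × R ≤ F) step F
  where
  step : ∀ F → (∀ {M} → M <ℕ F → P M → Σ ℕ λ R → IsMin P R × R ≤ M) → P F →
    Σ ℕ λ R → IsMin P R × R ≤ F
  step F rec PF with anyUpTo? P? F
  ... | yes (M , M<F , PM) =
    let (R , minimal , R≤M) = rec M<F PM in R , minimal , ≤-trans R≤M (<⇒≤ M<F)
  ... | no ∄smaller = F , (PF , λ M M<F PM → ∄smaller (M , M<F , PM)) , ≤-refl

theorem2p2 : (s n : ℕ) → 3 ≤ s → 3 ≤ n →
    (F : ℕ) → IsMin (FProp s (n ∸ 2)) F →
    Σ ℕ λ R → IsMin (RProp s n) R × R ≤ F
theorem2p2 s n _ 3≤n F (fProp , _) =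
  least (rProp? s n) λ c → LongestBluePath.redClique⊎blueMonotonePath c (<⇒≤ 3≤n) fProp
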